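{- Let $D$ be a connected graph on at least three vertices with $D\in\mathcal{U}$. Then $D$ is $2$-vertex-connected and $2$-edge-connected.
   Context: A graph is a symmetric digraph (loops allowed); an edge is a pair of opposite arcs between distinct vertices. $D\in\mathcal{U}$ means there is a unitary matrix $U$, indexed by the vertices, with $U_{v,w}\neq0$ iff $(v,w)$ is an arc. The vertex-connectivity is the smallest number of vertices whose removal increases the number of connected components; the edge-connectivity is the smallest number of edges whose removal increases the number of connected components; $D$ is $k$-vertex-connected ($k$-edge-connected) if this number is at least $k$. -}

module Defs where

open import Level using (Level; _⊔_) renaming (suc to lsuc)
open import Algebra.Bundles using (CommutativeRing)
open import Data.Nat using (ℕ; zero; suc; _<_)
open import Data.Fin using (Fin; _≟_)
open import Data.Bool using (Bool; true; false)
open import Data.List using (List; length)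
open import Data.List.Membership.Propositional using (_∈_; _∉_)
open import Data.Product using (_×_; _,_; ∃)
open import Data.Sum using (_⊎_)
open import Relation.Nullary using (¬_; does)
open import Relation.Binary.PropositionalEquality using (_≡_)

-- Scalars: a field with an involution (complex conjugation).
-- ℂ with complex conjugation is an instance; agda-stdlib has no ℂ
--.

record StarField (c ℓ : Level) : Set (lsuc (c ⊔ ℓ)) where
  field
    commRing : CommutativeRing c ℓ
  open CommutativeRing commRing public
  field
    conj            : Carrier → Carrier
    conj-cong       : ∀ {x y} → x ≈ y → conj x ≈ conj y
    conj-involutive : ∀ x → conj (conj x) ≈ x
    conj-+          : ∀ x y → conj (x + y) ≈ conj x + conj y
    conj-*          : ∀ x y → conj (x * y) ≈ conj x * conj y
    conj-1          : conj 1# ≈ 1#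
    1≉0             : ¬ (1# ≈ 0#)
    inverse         : ∀ x → ¬ (x ≈ 0#) → ∃ λ y → x * y ≈ 1#

-- Graphs: a digraph on vertex set Fin n given by its arc relation
-- (arc (v , w) present iff D v w ≡ true); loops allowed.

Digraph : ℕ → Set
Digraph n = Fin n → Fin n → Bool

-- symmetric digraph = graph
Symmetric : ∀ {n} → Digraph n → Set
Symmetric {n} D = ∀ (v w : Fin n) → D v w ≡ D w v

data Walk {n : ℕ} (E : Fin n → Fin n → Set) : Fin n → Fin n → Set where
  here  : ∀ {v} → Walk E v v
  step  : ∀ {u w v} → E u w → Walk E w v → Walk E u v

Arc : ∀ {n} → Digraph n → Fin n → Fin n → Set
Arc D u w = D u w ≡ true

Connected : ∀ {n} → Digraph n → Set
Connected {n} D = ∀ (u v : Fin n) → Walk (Arc D) u v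

ArcAvoiding : ∀ {n} → Digraph n → List (Fin n) → Fin n → Fin n → Set
ArcAvoiding D S u w = Arc D u w × u ∉ S × w ∉ S

ConnectedWithout : ∀ {n} → Digraph n → List (Fin n) → Set
ConnectedWithout {n} D S =
  ∀ (u v : Fin n) → u ∉ S → v ∉ S → Walk (ArcAvoiding D S) u v

-- For a connected graph D (one component), removing S increases the
-- number of components iff D - S is not connected.  Hence, for connected D,
-- "D is k-vertex-connected" (no set of fewer than k vertices whose removal
-- increases the number of components):
VertexConnected : ∀ {n} → ℕ → Digraph n → Set
VertexConnected {n} k D =
  ∀ (S : List (Fin n)) → length S < k → ConnectedWithout D S

IsEdge : ∀ {n} → Digraph n → Fin n × Fin n → Set
IsEdge D (u , w) = ¬ (u ≡ w) × Arc D u w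

ArcWithoutEdges : ∀ {n} → Digraph n → List (Fin n × Fin n) → Fin n → Fin n → Set
ArcWithoutEdges D F u w = Arc D u w × (u , w) ∉ F × (w , u) ∉ F

-- For connected D: k-edge-connected (no set of fewer than k edges whose
-- removal increases the number of components).
EdgeConnected : ∀ {n} → ℕ → Digraph n → Set
EdgeConnected {n} k D =
  ∀ (F : List (Fin n × Fin n)) → length F < k →
  (∀ e → e ∈ F → IsEdge D e) →
  ∀ (u v : Fin n) → Walk (ArcWithoutEdges D F) u v

module _ {c ℓ} (K : StarField c ℓ) where
  open StarField K

  Σ[_] : ∀ {n} → (Fin n → Carrier) → Carrier
  Σ[_] {zero}  f = 0#
  Σ[_] {suc n} f = f Fin.zero + Σ[_] {n} (λ i → f (Fin.suc i))

  δ : ∀ {n} → Fin n → Fin n → Carrier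
  δ i j = if does (i ≟ j) then 1# else 0#
    where open import Data.Bool using (if_then_else_)

  Unitary : ∀ {n} → (Fin n → Fin n → Carrier) → Set ℓ
  Unitary {n} U =
    (∀ (i j : Fin n) → Σ[ (λ k → U i k * conj (U j k)) ] ≈ δ i j) ×
    (∀ (i j : Fin n) → Σ[ (λ k → conj (U k i) * U k j) ] ≈ δ i j)

  InU : ∀ {n} → Digraph n → Set (c ⊔ ℓ)
  InU {n} D = ∃ λ (U : Fin n → Fin n → Carrier) → Unitary U ×
    (∀ (v w : Fin n) → (¬ (U v w ≈ 0#) → D v w ≡ true) × (D v w ≡ true → ¬ (U v w ≈ 0#)))

-- Rows x ≠ y of a unitary matrix are orthogonal, so their supports can never meet in
-- exactly one column: in D ∈ 𝒰, two distinct vertices with a common neighbour s have a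
-- second common neighbour z ≠ s.  A walk through a deleted vertex s enters and leaves
-- it through neighbours x and y, and x → z → y bypasses s; hence removing one vertex
-- keeps D connected.  Removing an edge ab is bypassed by a walk a → c → b through a third
-- vertex c, whose first half avoids the vertex b and whose second half avoids a.
module Submission where

open import Defs
open import Data.Nat using (ℕ; zero; suc; _≤_; s≤s)
open import Data.Product using (_×_; _,_; ∃; proj₁; proj₂)
open import Data.Product.Properties using (≡-dec)
open import Data.Sum using (_⊎_; inj₁; inj₂)
open import Data.Fin using (Fin; zero; suc; _≟_)
open import Data.Fin.Properties using (any?; suc-injective)
open import Data.Bool using (true)
import Data.Bool.Properties as Bool
open import Data.List using ([]; _∷_; [_])
open import Data.List.Relation.Unary.Any using (here)
open import Data.List.Membership.Propositional using (_∉_)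
open import Function using (_∘_)
open import Relation.Nullary using (¬_; yes; no)
open import Relation.Nullary.Decidable using (_×-dec_; ¬?; decidable-stable)
open import Relation.Nullary.Negation using (contradiction; ¬¬-map)
open import Relation.Binary.PropositionalEquality using (_≡_; _≢_; refl; sym; trans)

_++ʷ_ : ∀ {n} {E : Fin n → Fin n → Set} {u v w} → Walk E u v → Walk E v w → Walk E u w
here     ++ʷ q = q
step e p ++ʷ q = step e (p ++ʷ q)

module _ {n : ℕ} {E E′ : Fin n → Fin n → Set} where

  bindʷ : (∀ {a b} → E a b → Walk E′ a b) → ∀ {u v} → Walk E u v → Walk E′ u v
  bindʷ f here       = here
  bindʷ f (step e p) = f e ++ʷ bindʷ f p

  mapʷ : (∀ {a b} → E a b → E′ a b) → ∀ {u v} → Walk E u v → Walk E′ u v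
  mapʷ f = bindʷ (λ e → step (f e) here)

¬¬-∀-Fin : ∀ {n q} {Q : Fin n → Set q} → (∀ k → ¬ ¬ Q k) → ¬ ¬ (∀ k → Q k)
¬¬-∀-Fin {zero}  ¬¬Q ¬∀Q = ¬∀Q (λ ())
¬¬-∀-Fin {suc n} ¬¬Q ¬∀Q = ¬¬Q zero λ Q₀ →
  ¬¬-∀-Fin (λ k → ¬¬Q (suc k)) λ Qₛ → ¬∀Q λ { zero → Q₀ ; (suc k) → Qₛ k }

third-element : ∀ {n} → 3 ≤ n → (a b : Fin n) → ∃ λ c → c ≢ a × c ≢ b
third-element (s≤s (s≤s (s≤s _))) zero          zero          = suc zero , (λ ()) , (λ ())
third-element (s≤s (s≤s (s≤s _))) zero          (suc zero)    = suc (suc zero) , (λ ()) , (λ ())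
third-element (s≤s (s≤s (s≤s _))) zero          (suc (suc _)) = suc zero , (λ ()) , (λ ())
third-element (s≤s (s≤s (s≤s _))) (suc zero)    zero          = suc (suc zero) , (λ ()) , (λ ())
third-element (s≤s (s≤s (s≤s _))) (suc (suc _)) zero          = suc zero , (λ ()) , (λ ())
third-element (s≤s (s≤s (s≤s _))) (suc _)       (suc _)       = zero , (λ ()) , (λ ())

∉-[_] : ∀ {a} {A : Set a} {x y : A} → x ≢ y → x ∉ [ y ]
∉-[ x≢y ] (here x≡y) = x≢y x≡y

module StarFieldProperties {c ℓ} (K : StarField c ℓ) where
  open StarField K
    hiding (zero) renaming (refl to ≈-refl; sym to ≈-sym; trans to ≈-trans)
  open import Algebra.Properties.Ring ring using (x+x≈x⇒x≈0)
  open import Relation.Binary.Reasoning.Setoid setoid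

  conj-0 : conj 0# ≈ 0#
  conj-0 = x+x≈x⇒x≈0 (conj 0#)
    (≈-trans (≈-sym (conj-+ 0# 0#)) (conj-cong (+-identityʳ 0#)))

  conj≈0⇒≈0 : ∀ {x} → conj x ≈ 0# → x ≈ 0#
  conj≈0⇒≈0 {x} eq = ≈-trans (≈-sym (conj-involutive x)) (≈-trans (conj-cong eq) conj-0)

  x≉0∧x*y≈0⇒y≈0 : ∀ {x y} → x ≉ 0# → x * y ≈ 0# → y ≈ 0#
  x≉0∧x*y≈0⇒y≈0 {x} {y} x≉0 xy≈0 with inverse x x≉0
  ... | x⁻¹ , xx⁻¹≈1 = begin
    y              ≈⟨ *-identityˡ y ⟨
    1# * y         ≈⟨ *-congʳ (≈-trans (≈-sym xx⁻¹≈1) (*-comm x x⁻¹)) ⟩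
    (x⁻¹ * x) * y  ≈⟨ *-assoc x⁻¹ x y ⟩
    x⁻¹ * (x * y)  ≈⟨ *-congˡ xy≈0 ⟩
    x⁻¹ * 0#       ≈⟨ zeroʳ x⁻¹ ⟩
    0#             ∎

  Σ-≈0 : ∀ {n} (f : Fin n → Carrier) → (∀ k → f k ≈ 0#) → Σ[_] K f ≈ 0#
  Σ-≈0 {zero}  f f≈0 = ≈-refl
  Σ-≈0 {suc n} f f≈0 =
    ≈-trans (+-cong (f≈0 zero) (Σ-≈0 (λ k → f (suc k)) (λ k → f≈0 (suc k)))) (+-identityʳ 0#)

  Σ-single : ∀ {n} (f : Fin n → Carrier) (s : Fin n) →
             (∀ k → k ≢ s → f k ≈ 0#) → Σ[_] K f ≈ f s
  Σ-single {suc n} f zero f≈0 = ≈-trans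
    (+-congˡ (Σ-≈0 (λ k → f (suc k)) (λ k → f≈0 (suc k) (λ ()))))
    (+-identityʳ (f zero))
  Σ-single {suc n} f (suc s) f≈0 = ≈-trans
    (+-cong (f≈0 zero (λ ()))
            (Σ-single (λ k → f (suc k)) s (λ k k≢s → f≈0 (suc k) (k≢s ∘ suc-injective))))
    (+-identityˡ (f (suc s)))

  orthogonal⇒¬¬second-common-support :
    ∀ {n} (u v : Fin n → Carrier) → Σ[_] K (λ k → u k * conj (v k)) ≈ 0# →
    ∀ {s} → u s ≉ 0# → v s ≉ 0# → ¬ ¬ (∃ λ k → k ≢ s × u k ≉ 0# × v k ≉ 0#)
  orthogonal⇒¬¬second-common-support u v ⟨u,v⟩≈0 {s} us≉0 vs≉0 ¬second =
    ¬¬-∀-Fin term≈0 λ others≈0 →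
      vs≉0 (conj≈0⇒≈0 (x≉0∧x*y≈0⇒y≈0 us≉0 (begin
        u s * conj (v s)                 ≈⟨ Σ-single (λ k → u k * conj (v k)) s others≈0 ⟨
        Σ[_] K (λ k → u k * conj (v k))  ≈⟨ ⟨u,v⟩≈0 ⟩
        0#                               ∎)))
    where
    term≈0 : ∀ k → ¬ ¬ (k ≢ s → u k * conj (v k) ≈ 0#)
    term≈0 k ¬term≈0 = ¬second (k , k≢s , uk≉0 , vk≉0)
      where
      k≢s : k ≢ s
      k≢s k≡s = ¬term≈0 (λ k≢s → contradiction k≡s k≢s)
      uk≉0 : u k ≉ 0#
      uk≉0 uk≈0 = ¬term≈0 (λ _ → ≈-trans (*-congʳ uk≈0) (zeroˡ _))
      vk≉0 : v k ≉ 0#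
      vk≉0 vk≈0 = ¬term≈0 (λ _ → ≈-trans (*-congˡ (≈-trans (conj-cong vk≈0) conj-0)) (zeroʳ _))

  δ-≢ : ∀ {n} {i j : Fin n} → i ≢ j → δ K i j ≈ 0#
  δ-≢ {i = i} {j} i≢j with i ≟ j
  ... | yes i≡j = contradiction i≡j i≢j
  ... | no _    = ≈-refl

NoUniqueCommonNeighbour : ∀ {n} → Digraph n → Set
NoUniqueCommonNeighbour {n} D = ∀ {x y s : Fin n} → x ≢ y → Arc D x s → Arc D y s →
  ∃ λ z → z ≢ s × Arc D x z × Arc D y z

InU⇒NoUniqueCommonNeighbour : ∀ {c ℓ} (K : StarField c ℓ) {n} {D : Digraph n} →
                              InU K D → NoUniqueCommonNeighbour D
InU⇒NoUniqueCommonNeighbour K {D = D} (U , (rows , _) , support) {x} {y} {s} x≢y xs ys =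
  decidable-stable (any? λ z → ¬? (z ≟ s) ×-dec (D x z Bool.≟ true) ×-dec (D y z Bool.≟ true))
    (¬¬-map (λ (z , z≢s , xz , yz) → z , z≢s , proj₁ (support x z) xz , proj₁ (support y z) yz)
      (orthogonal⇒¬¬second-common-support (U x) (U y)
        (StarField.trans K (rows x y) (δ-≢ x≢y))
        (proj₂ (support x s) xs) (proj₂ (support y s) ys)))
  where open StarFieldProperties K

module TwoConnectivity {n} {D : Digraph n} (symmetric : Symmetric D) (connected : Connected D)
                       (noUnique : NoUniqueCommonNeighbour D) where

  Avoiding : Fin n → Fin n → Fin n → Set
  Avoiding s = ArcAvoiding D [ s ]

  arc-avoiding : ∀ {s u w} → Arc D u w → u ≢ s → w ≢ s → Avoiding s u w
  arc-avoiding uw u≢s w≢s = uw , ∉-[ u≢s ] , ∉-[ w≢s ]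

  bypass : ∀ {x y} s → x ≢ s → y ≢ s → Arc D x s → Arc D s y → Walk (Avoiding s) x y
  bypass {x} {y} s x≢s y≢s xs sy with x ≟ y
  ... | yes refl = here
  ... | no x≢y with noUnique x≢y xs (trans (symmetric y s) sy)
  ... | z , z≢s , xz , yz =
    step (arc-avoiding xz x≢s z≢s) (step (arc-avoiding (trans (symmetric z y) yz) z≢s y≢s) here)

  mutual
    avoid : ∀ {u v} s → u ≢ s → v ≢ s → Walk (Arc D) u v → Walk (Avoiding s) u v
    avoid s u≢s v≢s here = here
    avoid s u≢s v≢s (step {w = w} uw p) with w ≟ s
    ... | no w≢s   = step (arc-avoiding uw u≢s w≢s) (avoid s w≢s v≢s p)
    ... | yes refl = avoid-after s u≢s uw v≢s p

    -- x is the last vertex before the walk entered s; loops at s are skipped.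
    avoid-after : ∀ {x v} s → x ≢ s → Arc D x s → v ≢ s → Walk (Arc D) s v →
                  Walk (Avoiding s) x v
    avoid-after s x≢s xs v≢s here = contradiction refl v≢s
    avoid-after s x≢s xs v≢s (step {w = y} sy p) with y ≟ s
    ... | yes refl = avoid-after s x≢s xs v≢s p
    ... | no y≢s   = bypass s x≢s y≢s xs sy ++ʷ avoid s y≢s v≢s p

  vertexConnected : VertexConnected 2 D
  vertexConnected []          _ u v _   _   = mapʷ (λ uw → uw , (λ ()) , (λ ())) (connected u v)
  vertexConnected (s ∷ [])    _ u v u∉S v∉S = avoid s (u∉S ∘ here) (v∉S ∘ here) (connected u v)
  vertexConnected (_ ∷ _ ∷ _) (s≤s (s≤s ()))

  module WithoutEdge {a b c : Fin n} (a≢b : a ≢ b) (c≢a : c ≢ a) (c≢b : c ≢ b) where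

    Remaining : Fin n → Fin n → Set
    Remaining = ArcWithoutEdges D [ (a , b) ]

    touches : ∀ {s p q} → s ≡ a ⊎ s ≡ b → (p , q) ≡ (a , b) → p ≡ s ⊎ q ≡ s
    touches (inj₁ refl) refl = inj₁ refl
    touches (inj₂ refl) refl = inj₂ refl

    avoiding-endpoint : ∀ {s u w} → s ≡ a ⊎ s ≡ b → Avoiding s u w → Remaining u w
    avoiding-endpoint {s} s∈ab (uw , u∉s , w∉s) = uw , missing u∉s w∉s , missing w∉s u∉s
      where
      missing : ∀ {p q} → p ∉ [ s ] → q ∉ [ s ] → (p , q) ∉ [ (a , b) ]
      missing p∉s q∉s (here pq≡ab) with touches s∈ab pq≡ab
      ... | inj₁ p≡s = p∉s (here p≡s)
      ... | inj₂ q≡s = q∉s (here q≡s)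

    detour : ∀ {x y} → x ≢ y → c ≢ x → c ≢ y → x ≡ a ⊎ x ≡ b → y ≡ a ⊎ y ≡ b →
             Walk Remaining x y
    detour {x} {y} x≢y c≢x c≢y x∈ab y∈ab =
      mapʷ (avoiding-endpoint y∈ab) (avoid y x≢y c≢y (connected x c)) ++ʷ
      mapʷ (avoiding-endpoint x∈ab) (avoid x c≢x (x≢y ∘ sym) (connected c y))

    replace-edge : ∀ {u w} → Arc D u w → Walk Remaining u w
    replace-edge {u} {w} uw with ≡-dec _≟_ _≟_ (u , w) (a , b) | ≡-dec _≟_ _≟_ (w , u) (a , b)
    ... | yes refl | _        = detour a≢b c≢a c≢b (inj₁ refl) (inj₂ refl)
    ... | no _     | yes refl = detour (a≢b ∘ sym) c≢b c≢a (inj₂ refl) (inj₁ refl)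
    ... | no uw≢ab | no wu≢ab = step (uw , ∉-[ uw≢ab ] , ∉-[ wu≢ab ]) here

  edgeConnected : 3 ≤ n → EdgeConnected 2 D
  edgeConnected _ [] _ _ u v = mapʷ (λ uw → uw , (λ ()) , (λ ())) (connected u v)
  edgeConnected 3≤n ((a , b) ∷ []) _ isEdge u v with third-element 3≤n a b
  ... | c , c≢a , c≢b =
    bindʷ (WithoutEdge.replace-edge (proj₁ (isEdge (a , b) (here refl))) c≢a c≢b) (connected u v)
  edgeConnected _ (_ ∷ _ ∷ _) (s≤s (s≤s ()))

mainTheorem15 : ∀ {c ℓ} (K : StarField c ℓ) (n : ℕ) (D : Digraph n) →
    3 ≤ n → Symmetric D → Connected D → InU K D →
    VertexConnected 2 D × EdgeConnected 2 D
mainTheorem15 K n D 3≤n symmetric connected D∈𝒰 = vertexConnected , edgeConnected 3≤n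
  where open TwoConnectivity symmetric connected (InU⇒NoUniqueCommonNeighbour K D∈𝒰)
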